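{- Let $s\ge1$ and let $(c,a_1,\dots,a_s)$ be positive integers with $\gcd(c,a_1,\dots,a_s)=1$, and $a_i\mid c$ and $a_i<c$ for all $i$. If $(\mathbf{d},\mathbf{r})$ is the (unique) smooth arithmetical structure on a coconut tree $\mathcal{CT}(p,s)$ with $r_{\ell_i}=a_i$ for all $i$ and $r_p=c$, then \[p=F\Bigl(\sum_{j=1}^{s}a_j,\;c\Bigr)-1.\]
   Context: The coconut tree $\mathcal{CT}(p,s)$ is the graph with vertices $v_1,\dots,v_p,v_{\ell_1},\dots,v_{\ell_s}$ and edges $v_iv_{i+1}$ ($1\le i\le p-1$) and $v_pv_{\ell_j}$ ($1\le j\le s$). An arithmetical structure on a finite connected simple graph is a pair $(\mathbf{d},\mathbf{r})$ of vectors of positive integers indexed by the vertices such that for every vertex $v$, $d_vr_v$ equals the sum of $r_u$ over the neighbors $u$ of $v$, and the entries of $\mathbf{r}$ have gcd $1$. On $\mathcal{CT}(p,s)$ write $\mathbf{r}=(r_1,\dots,r_p,r_{\ell_1},\dots,r_{\ell_s})$, similarly for $\mathbf{d}$; the structure is smooth if $d_1,\dots,d_{p-1},d_{\ell_1},\dots,d_{\ell_s}\ge2$. For integers $a$, $b>0$, $a\bmod b$ is the least nonnegative residue. A Euclidean chain is a sequence $(x_i)_{i\ge1}$ with $x_1\in\mathbb{N}$, $x_2\in\mathbb{N}\cup\{0\}$ and for $i\ge2$: $x_{i+1}=(-x_{i-1})\bmod x_i$ if $x_i\notin\{0,1\}$, else $x_{i+1}=0$; $F(x_1,x_2)$ is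 the largest index $i$ with $x_i\ne0$. -}

module Defs where

open import Data.Nat using (ℕ; zero; suc; _+_; _*_; _∸_; _≤_; _<_; _≡ᵇ_)
open import Data.Nat.DivMod using (_%_)
open import Data.Nat.GCD using (gcd)
open import Data.Fin using (Fin; toℕ)
open import Data.Sum using (_⊎_; inj₁; inj₂)
open import Data.Product using (_×_; _,_; proj₁)
open import Data.Bool using (Bool; true; false; _∨_)
open import Data.Vec.Functional using (foldr)
open import Relation.Binary.PropositionalEquality using (_≡_; _≢_)

Σᶠ : ∀ {n} → (Fin n → ℕ) → ℕ
Σᶠ f = foldr _+_ 0 f

-- gcd of all entries of a vector (gcd of the empty family is 0)
gcdᶠ : ∀ {n} → (Fin n → ℕ) → ℕ
gcdᶠ f = foldr gcd 0 f

-- The coconut tree CT(p,s).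
-- Vertices: inj₁ i  (i : Fin p) is v_{i+1} on the path,
--           inj₂ j  (j : Fin s) is the leaf v_{ℓ_{j+1}}.

CTV : ℕ → ℕ → Set
CTV p s = Fin p ⊎ Fin s

ctAdj : (p s : ℕ) → CTV p s → CTV p s → Bool
ctAdj p s (inj₁ i) (inj₁ j) = (suc (toℕ i) ≡ᵇ toℕ j) ∨ (suc (toℕ j) ≡ᵇ toℕ i)
ctAdj p s (inj₁ i) (inj₂ _) = toℕ i ≡ᵇ (p ∸ 1)
ctAdj p s (inj₂ _) (inj₁ j) = toℕ j ≡ᵇ (p ∸ 1)
ctAdj p s (inj₂ _) (inj₂ _) = false

sumV : (p s : ℕ) → (CTV p s → ℕ) → ℕ
sumV p s f = Σᶠ (λ i → f (inj₁ i)) + Σᶠ (λ j → f (inj₂ j))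

nbrSum : (p s : ℕ) → (CTV p s → ℕ) → CTV p s → ℕ
nbrSum p s r v = sumV p s (λ u → sel (ctAdj p s v u) (r u))
  where
  sel : Bool → ℕ → ℕ
  sel true  x = x
  sel false _ = 0

gcdV : (p s : ℕ) → (CTV p s → ℕ) → ℕ
gcdV p s r = gcd (gcdᶠ (λ i → r (inj₁ i))) (gcdᶠ (λ j → r (inj₂ j)))

IsArithStructure : (p s : ℕ) → (d r : CTV p s → ℕ) → Set
IsArithStructure p s d r =
  (∀ v → 1 ≤ d v) × (∀ v → 1 ≤ r v) ×
  (∀ v → d v * r v ≡ nbrSum p s r v) ×
  (gcdV p s r ≡ 1)

IsSmooth : (p s : ℕ) → (d : CTV p s → ℕ) → Set
IsSmooth p s d =
  (∀ (i : Fin p) → suc (toℕ i) < p → 2 ≤ d (inj₁ i)) ×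
  (∀ (j : Fin s) → 2 ≤ d (inj₂ j))

-- next term: x_{i+1} = (-x_{i-1}) mod x_i if x_i ∉ {0,1}, else 0
nextTerm : ℕ → ℕ → ℕ
nextTerm prev zero = 0
nextTerm prev (suc zero) = 0
nextTerm prev (suc (suc k)) = (suc (suc k) ∸ (prev % suc (suc k))) % suc (suc k)

-- pairAt x₁ x₂ n = (x_{n+1} , x_{n+2})
pairAt : ℕ → ℕ → ℕ → ℕ × ℕ
pairAt x₁ x₂ zero = x₁ , x₂
pairAt x₁ x₂ (suc n) with pairAt x₁ x₂ n
... | a , b = b , nextTerm a b

-- chain x₁ x₂ i = x_i for i ≥ 1 (index 0 is unused and set to 0)
chain : ℕ → ℕ → ℕ → ℕ
chain x₁ x₂ zero = 0
chain x₁ x₂ (suc n) = proj₁ (pairAt x₁ x₂ n)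

IsF : ℕ → ℕ → ℕ → Set
IsF x₁ x₂ n = (chain x₁ x₂ n ≢ 0) × (∀ m → n < m → chain x₁ x₂ m ≡ 0)

-- Read the values of r along the path backwards, preceded by 0 and followed by the sum of
-- the leaf values: w₀ = 0, w_{t+1} = r(v_{t+1}), w_{p+1} = Σ a.  The balance condition at
-- v_{t+1} says d·w_{t+1} = w_t + w_{t+2}, so w_{t+2} ≡ −w_t (mod w_{t+1}); smoothness
-- (d ≥ 2) makes w convex, hence strictly increasing from w₀ = 0.  So the Euclidean chain
-- started at (w_{p+1}, w_p) runs down through w_{p-1}, …, w₁ and then 0, and its last
-- nonzero term is x_{p+1} = w₁.
module Submission where

open import Data.Fin using (Fin; zero; suc; toℕ; fromℕ<)
open import Data.Fin.Properties using (toℕ-fromℕ<)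
open import Data.Nat
open import Data.Nat.Divisibility using (_∣_; divides; n∣m⇒m%n≡0)
open import Data.Nat.DivMod using (_%_; n%n≡0; [m+kn]%n≡m%n; m<n⇒m%n≡m)
open import Data.Nat.GCD using (gcd)
open import Data.Nat.Properties
open import Algebra.Properties.Monoid.Sum +-0-monoid using (sum-cong-≗; sum-replicate-zero)
open import Data.Product using (_,_; proj₁)
open import Data.Sum using (inj₁; inj₂; map₁)
open import Function using (_∘_)
open import Relation.Binary.PropositionalEquality
open import Defs

nextTerm-complement : ∀ {x z m} → z < m → m ∣ z + x → nextTerm x m ≡ z
nextTerm-complement {z = zero}  {suc zero}    _         _  = refl
nextTerm-complement {z = suc _} {suc zero}    (s≤s ())  _
nextTerm-complement {x} {zero} {m@(suc (suc _))} _ m∣x = begin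
  (m ∸ x % m) % m  ≡⟨ cong (λ ρ → (m ∸ ρ) % m) (n∣m⇒m%n≡0 x m m∣x) ⟩
  m % m            ≡⟨ n%n≡0 m ⟩
  0                ∎
  where open ≡-Reasoning
nextTerm-complement {x} {z@(suc _)} {m@(suc (suc _))} z<m (divides (suc e) z+x≡m+em) = begin
  (m ∸ x % m) % m    ≡⟨ cong (λ ρ → (m ∸ ρ) % m) x%m≡m∸z ⟩
  (m ∸ (m ∸ z)) % m  ≡⟨ cong (_% m) (m∸[m∸n]≡n (<⇒≤ z<m)) ⟩
  z % m              ≡⟨ m<n⇒m%n≡m z<m ⟩
  z                  ∎
  where
  open ≡-Reasoning
  x≡m∸z+em : x ≡ (m ∸ z) + e * m
  x≡m∸z+em = +-cancelˡ-≡ z x _ (begin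
    z + x                    ≡⟨ z+x≡m+em ⟩
    m + e * m                ≡⟨ cong (_+ e * m) (m+[n∸m]≡n (<⇒≤ z<m)) ⟨
    z + (m ∸ z) + e * m      ≡⟨ +-assoc z (m ∸ z) (e * m) ⟩
    z + ((m ∸ z) + e * m)    ∎)
  x%m≡m∸z : x % m ≡ m ∸ z
  x%m≡m∸z = begin
    x % m                    ≡⟨ cong (_% m) x≡m∸z+em ⟩
    ((m ∸ z) + e * m) % m    ≡⟨ [m+kn]%n≡m%n (m ∸ z) e m ⟩
    (m ∸ z) % m              ≡⟨ m<n⇒m%n≡m (∸-monoʳ-< {m} {z} {0} (s≤s z≤n) (<⇒≤ z<m)) ⟩
    m ∸ z                    ∎

pairAt-step : ∀ {x₁ x₂ k a b} → pairAt x₁ x₂ k ≡ (a , b) → pairAt x₁ x₂ (suc k) ≡ (b , nextTerm a b)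
pairAt-step = cong λ (a , b) → b , nextTerm a b

pairAt-stays-zero : ∀ {x₁ x₂ k j} → pairAt x₁ x₂ k ≡ (0 , 0) → k ≤′ j → pairAt x₁ x₂ j ≡ (0 , 0)
pairAt-stays-zero vanish ≤′-refl         = vanish
pairAt-stays-zero vanish (≤′-step k≤′j) = pairAt-step (pairAt-stays-zero vanish k≤′j)

convex⇒increasing : ∀ (w : ℕ → ℕ) n → w 0 < w 1 →
                    (∀ t → t < n → w (suc t) + w (suc t) ≤ w t + w (2 + t)) →
                    ∀ t → t ≤ n → w t < w (suc t)
convex⇒increasing w n w₀<w₁ convex zero    _   = w₀<w₁
convex⇒increasing w n w₀<w₁ convex (suc t) t<n = +-cancelˡ-< (w (suc t)) _ _ (begin-strict
  w (suc t) + w (suc t)  ≤⟨ convex t t<n ⟩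
  w t + w (2 + t)        <⟨ +-monoˡ-< (w (2 + t)) (convex⇒increasing w n w₀<w₁ convex t (<⇒≤ t<n)) ⟩
  w (suc t) + w (2 + t)  ∎)
  where open ≤-Reasoning

module _ (w : ℕ → ℕ) (n : ℕ)
         (increasing : ∀ t → t ≤ n → w t < w (suc t))
         (w[1+t]∣w[t]+w[2+t] : ∀ t → t ≤ n → w (suc t) ∣ w t + w (2 + t))
         where

  pairAt-descends : ∀ k t → k + t ≡ suc n → pairAt (w (2 + n)) (w (1 + n)) k ≡ (w (suc t) , w t)
  pairAt-descends zero    t refl = refl
  pairAt-descends (suc k) t k+1+t≡1+n = trans
    (pairAt-step (pairAt-descends k (suc t) (trans (+-suc k t) k+1+t≡1+n)))
    (cong (w (suc t) ,_) (nextTerm-complement (increasing t t≤n) (w[1+t]∣w[t]+w[2+t] t t≤n)))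
    where
    t≤n : t ≤ n
    t≤n = ≤-trans (m≤n+m t k) (≤-reflexive (suc-injective k+1+t≡1+n))

  descending-isF : w 0 ≡ 0 → IsF (w (2 + n)) (w (1 + n)) (2 + n)
  descending-isF w₀≡0 =
    subst (_≢ 0) (sym (cong proj₁ ends-at-w₁)) (m<n⇒n≢0 (increasing 0 z≤n)) , vanishes-after
    where
    ends-at-w₁ : pairAt (w (2 + n)) (w (1 + n)) (suc n) ≡ (w 1 , 0)
    ends-at-w₁ = trans (pairAt-descends (suc n) 0 (+-identityʳ (suc n))) (cong (w 1 ,_) w₀≡0)
    vanishes-from : pairAt (w (2 + n)) (w (1 + n)) (2 + n) ≡ (0 , 0)
    vanishes-from = pairAt-step {k = suc n} ends-at-w₁
    vanishes-after : ∀ m → 2 + n < m → chain (w (2 + n)) (w (1 + n)) m ≡ 0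
    vanishes-after (suc m) 2+n<1+m =
      cong proj₁ (pairAt-stays-zero vanishes-from (≤⇒≤′ (s≤s⁻¹ 2+n<1+m)))

extendBy : ∀ {p} → (Fin p → ℕ) → ℕ → ℕ → ℕ
extendBy {zero}  R d _       = d
extendBy {suc p} R d zero    = R zero
extendBy {suc p} R d (suc t) = extendBy (R ∘ suc) d t

extendBy-fromℕ< : ∀ {p} (R : Fin p → ℕ) d {t} (t<p : t < p) → extendBy R d t ≡ R (fromℕ< t<p)
extendBy-fromℕ< {suc p} R d {zero}  _           = refl
extendBy-fromℕ< {suc p} R d {suc t} (s≤s t<p) = extendBy-fromℕ< (R ∘ suc) d t<p

extendBy-beyond : ∀ {p} (R : Fin p → ℕ) d → extendBy R d p ≡ d
extendBy-beyond {zero}  R d = refl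
extendBy-beyond {suc p} R d = extendBy-beyond (R ∘ suc) d

-- pathProfile r t = r(v_t) for 1 ≤ t ≤ p.  For the balance conditions along the path the
-- leaves act like one extra vertex v_{p+1} carrying their sum, and v₁ like a vertex with an
-- extra neighbour v₀ carrying 0.
pathProfile : ∀ {p s} → (CTV p s → ℕ) → ℕ → ℕ
pathProfile r zero    = 0
pathProfile r (suc t) = extendBy (r ∘ inj₁) (Σᶠ (r ∘ inj₂)) t

-- Restricting r along map₁ suc deletes v₁ and leaves the neighbour sums at v₃, v₄, … intact.
nbrSum-path : ∀ q s (r : CTV (suc q) s → ℕ) {t} (t<1+q : t < suc q) →
              nbrSum (suc q) s r (inj₁ (fromℕ< t<1+q)) ≡ pathProfile r t + pathProfile r (2 + t)
nbrSum-path zero    s r {zero}        _ = refl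
nbrSum-path zero    s r {suc _}       (s≤s ())
nbrSum-path (suc q) s r {zero}        _ = begin
  r (inj₁ (suc zero)) + Σᶠ {q} (λ _ → 0) + Σᶠ {s} (λ _ → 0)
    ≡⟨ cong₂ (λ x y → r (inj₁ (suc zero)) + x + y) (sum-replicate-zero q) (sum-replicate-zero s) ⟩
  r (inj₁ (suc zero)) + 0 + 0
    ≡⟨ trans (+-identityʳ _) (+-identityʳ _) ⟩
  r (inj₁ (suc zero))                                          ∎
  where open ≡-Reasoning
nbrSum-path (suc q) s r {suc zero}    _ =
  trans (+-assoc (r (inj₁ zero)) _ _) (cong (r (inj₁ zero) +_) (nbrSum-path q s (r ∘ map₁ suc) (s≤s z≤n)))
nbrSum-path (suc q) s r {suc (suc t)} (s≤s t+1<1+q) = nbrSum-path q s (r ∘ map₁ suc) t+1<1+q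

pathProfile-recurrence : ∀ {q s} {d r : CTV (suc q) s → ℕ} →
                         (∀ v → d v * r v ≡ nbrSum (suc q) s r v) →
                         ∀ {t} (t<1+q : t < suc q) →
                         d (inj₁ (fromℕ< t<1+q)) * pathProfile r (suc t) ≡ pathProfile r t + pathProfile r (2 + t)
pathProfile-recurrence {q} {s} {d} {r} balanced {t} t<1+q = begin
  d v * pathProfile r (suc t)               ≡⟨ cong (d v *_) (extendBy-fromℕ< (r ∘ inj₁) _ t<1+q) ⟩
  d v * r v                                 ≡⟨ balanced v ⟩
  nbrSum (suc q) s r v                      ≡⟨ nbrSum-path q s r t<1+q ⟩
  pathProfile r t + pathProfile r (2 + t)   ∎
  where
  open ≡-Reasoning
  v : CTV (suc q) s
  v = inj₁ (fromℕ< t<1+q)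

m+m≤n*m : ∀ m {n} → 2 ≤ n → m + m ≤ n * m
m+m≤n*m m {n} 2≤n = begin
  m + m  ≡⟨ cong (m +_) (+-identityʳ m) ⟨
  2 * m  ≤⟨ *-monoˡ-≤ m 2≤n ⟩
  n * m  ∎
  where open ≤-Reasoning

corollary4p19 :
    (s : ℕ) → 1 ≤ s → (c : ℕ) → (a : Fin s → ℕ) →
    1 ≤ c → (∀ i → 1 ≤ a i) →
    gcd c (gcdᶠ a) ≡ 1 →
    (∀ i → a i ∣ c) → (∀ i → a i < c) →
    (q : ℕ) → (d r : CTV (suc q) s → ℕ) →
    IsArithStructure (suc q) s d r → IsSmooth (suc q) s d →
    (∀ i → r (inj₂ i) ≡ a i) →
    r (inj₁ (fromℕ< (n<1+n q))) ≡ c →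
    IsF (Σᶠ a) c (suc (suc q))
corollary4p19 s _ c a _ _ _ _ _ q d r (_ , r-pos , balanced , _) (smooth-path , _) r-leaves r-last =
  subst₂ (λ x y → IsF x y (2 + q)) w[2+q]≡Σa w[1+q]≡c
    (descending-isF w q increasing w[1+t]∣w[t]+w[2+t] refl)
  where
  w : ℕ → ℕ
  w = pathProfile r
  recurrence : ∀ {t} (t≤q : t ≤ q) → d (inj₁ (fromℕ< (s≤s t≤q))) * w (suc t) ≡ w t + w (2 + t)
  recurrence t≤q = pathProfile-recurrence {d = d} balanced (s≤s t≤q)
  w[1+t]∣w[t]+w[2+t] : ∀ t → t ≤ q → w (suc t) ∣ w t + w (2 + t)
  w[1+t]∣w[t]+w[2+t] t t≤q = divides (d (inj₁ (fromℕ< (s≤s t≤q)))) (sym (recurrence t≤q))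
  smooth-inner : ∀ {t} (t<q : t < q) → 2 ≤ d (inj₁ (fromℕ< (m<n⇒m<1+n t<q)))
  smooth-inner t<q = smooth-path _ (s≤s (subst (_< q) (sym (toℕ-fromℕ< _)) t<q))
  convex : ∀ t → t < q → w (suc t) + w (suc t) ≤ w t + w (2 + t)
  convex t t<q = ≤-trans (m+m≤n*m (w (suc t)) (smooth-inner t<q)) (≤-reflexive (recurrence (<⇒≤ t<q)))
  increasing : ∀ t → t ≤ q → w t < w (suc t)
  increasing = convex⇒increasing w q (r-pos (inj₁ zero)) convex
  w[2+q]≡Σa : w (2 + q) ≡ Σᶠ a
  w[2+q]≡Σa = trans (extendBy-beyond (r ∘ inj₁) _) (sum-cong-≗ r-leaves)
  w[1+q]≡c : w (1 + q) ≡ c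
  w[1+q]≡c = trans (extendBy-fromℕ< (r ∘ inj₁) _ (n<1+n q)) r-last
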